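{- Let $G$ be a triangle-free graph and let $u,v\in V(G)$ be two non-adjacent vertices. If $u$ and $v$ are not twins (i.e., $N_G(u)\neq N_G(v)$), then $\tau(G_{T_G(u)\rightarrow v})<\tau(G)$.
   Context: All graphs are finite, simple and undirected; $N_G(x)$ denotes the open neighborhood of $x$. Two vertices $x,y$ are (false) twins if $N_G(x)=N_G(y)$. For $x\in V(G)$, the twin set of $x$ is $T_G(x)=\{y\in V(G): N_G(y)=N_G(x)\}$; the twin sets partition $V(G)$, and $\tau(G)$ denotes the number of twin sets of $G$. For two non-adjacent vertices $u,v$ of $G$, $G_{T_G(u)\rightarrow v}$ is the graph obtained from $G$ as follows: for every $u'\in T_G(u)$, delete the edge $u'x$ for every $x\in N_G(u)\setminus N_G(v)$ and add the edge $u'y$ for every $y\in N_G(v)\setminus N_G(u)$. -}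

module Defs where

open import Data.Nat using (ℕ; _<ᵇ_)
open import Data.Bool using (Bool; true; false; _∧_; _∨_; not; if_then_else_)
open import Data.Fin using (Fin; toℕ)
open import Data.List using (List; length; filter; allFin)
open import Data.Bool.ListAction using (all; any)
open import Data.Product using (Σ; _×_)
open import Data.Empty using (⊥)
open import Relation.Nullary using (¬_)
open import Relation.Binary.PropositionalEquality using (_≡_)
open import Relation.Unary using (Pred)
open import Relation.Nullary.Decidable using (does)
import Data.Bool as B

record Graph (n : ℕ) : Set where
  field
    adj    : Fin n → Fin n → Bool
    sym    : ∀ x y → adj x y ≡ adj y x
    irrefl : ∀ x → adj x x ≡ false
open Graph public

_==_ : Bool → Bool → Bool
a == b = does (a B.≟ b)

twinᵇ : ∀ {n} → (Fin n → Fin n → Bool) → Fin n → Fin n → Bool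
twinᵇ {n} a x y = all (λ z → a x z == a y z) (allFin n)

isRepᵇ : ∀ {n} → (Fin n → Fin n → Bool) → Fin n → Bool
isRepᵇ {n} a x = not (any (λ y → (toℕ y <ᵇ toℕ x) ∧ twinᵇ a y x) (allFin n))

-- τ : number of twin sets (= number of least representatives of twin classes)
τ : ∀ {n} → (Fin n → Fin n → Bool) → ℕ
τ {n} a = length (filter (λ x → isRepᵇ a x B.≟ true) (allFin n))

-- Adjacency of G_{T_G(u) → v}:
-- E' = (E \ {u'x : u' ∈ T(u), x ∈ N(u) \ N(v)}) ∪ {u'y : u' ∈ T(u), y ∈ N(v) \ N(u)}
moveAdj : ∀ {n} → Graph n → Fin n → Fin n → Fin n → Fin n → Bool
moveAdj G u v a b =
  (adj G a b ∧ not (del a b ∨ del b a)) ∨ (add a b ∨ add b a)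
  where
    inT : _ → Bool
    inT w = twinᵇ (adj G) w u
    del : _ → _ → Bool
    del p x = inT p ∧ (adj G u x ∧ not (adj G v x))
    add : _ → _ → Bool
    add p y = inT p ∧ (adj G v y ∧ not (adj G u y))

TriangleFree : ∀ {n} → Graph n → Set
TriangleFree {n} G = ∀ (x y z : Fin n) →
  adj G x y ≡ true → adj G y z ≡ true → adj G x z ≡ true → ⊥

Twins : ∀ {n} → Graph n → Fin n → Fin n → Set
Twins {n} G x y = ∀ (z : Fin n) → adj G x z ≡ adj G y z

module Submission where

-- Write A for the adjacency of G and A' for that of G' = G_{T(u)→v}.
-- The argument has two independent halves.
--
-- If
--     every pair of A-twins is an A'-twin, every A'-representative is an
--     A-representative; if moreover some two non-A-twins become A'-twins, the
--     later of their two A-representatives stops being an A'-representative,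
--     so τ A' < τ A  (τ-decreases).
--
-- The rows of A' are computed explicitly (rows of T(u) become
--     the row of v, the column of T(u) becomes the column of v, everything
--     else is unchanged).  From this, twins of G stay twins in G', and u and v
--     become twins in G'.

open import Defs hiding (sym)
open import Level using (Level)
open import Data.Nat using (ℕ; _<_; _≤_; z≤n; s≤s)
open import Data.Nat.Properties using (<ᵇ⇒<; <⇒<ᵇ; <-cmp; m≤n⇒m≤1+n)
open import Data.Fin using (Fin; toℕ)
import Data.Fin as Fin
open import Data.Fin.Induction using (<-wellFounded)
open import Data.Fin.Properties using (toℕ-injective)
open import Data.Bool using (Bool; true; false; _∧_; _∨_; not; T)
import Data.Bool as B
open import Data.Bool.Properties using (T-≡; T-∧; not-injective)
open import Data.Bool.ListAction using (and)
open import Data.List using ([]; _∷_; length; filter; allFin)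
open import Data.List.Properties using (map-cong)
open import Data.List.Membership.Propositional using (_∈_; lose)
open import Data.List.Membership.Propositional.Properties using (∈-allFin)
open import Data.List.Relation.Unary.Any using (here; there; satisfied)
import Data.List.Relation.Unary.All as All
open import Data.List.Relation.Unary.All.Properties using (all⁺; all⁻)
open import Data.List.Relation.Unary.Any.Properties using (any⁺; any⁻)
open import Data.Product using (∃; _×_; _,_)
open import Data.Sum using (_⊎_; inj₁; inj₂)
open import Data.Unit using (tt)
open import Function using (Equivalence)
open import Induction.WellFounded using (Acc; acc)
open import Relation.Binary using (tri<; tri≈; tri>)
open import Relation.Nullary using (¬_; yes; no; contradiction)
open import Relation.Unary using (Pred; Decidable; _⊆_)
open import Relation.Binary.PropositionalEquality
  using (_≡_; refl; sym; trans; cong; module ≡-Reasoning)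

module _ {a p q : Level} {A : Set a} {P : Pred A p} {Q : Pred A q}
         (P? : Decidable P) (Q? : Decidable Q) (P⊆Q : P ⊆ Q) where

  count-≤ : ∀ xs → length (filter P? xs) ≤ length (filter Q? xs)
  count-≤ [] = z≤n
  count-≤ (x ∷ xs) with P? x | Q? x
  ... | yes _  | yes _  = s≤s (count-≤ xs)
  ... | yes px | no ¬qx = contradiction (P⊆Q px) ¬qx
  ... | no _   | yes _  = m≤n⇒m≤1+n (count-≤ xs)
  ... | no _   | no _   = count-≤ xs

  count-< : ∀ xs {z} → z ∈ xs → ¬ P z → Q z →
            length (filter P? xs) < length (filter Q? xs)
  count-< (x ∷ xs) (here refl) ¬pz qz with P? x | Q? x
  ... | yes pz | _      = contradiction pz ¬pz
  ... | no _   | yes _  = s≤s (count-≤ xs)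
  ... | no _   | no ¬qz = contradiction qz ¬qz
  count-< (x ∷ xs) (there z∈xs) ¬pz qz with P? x | Q? x
  ... | yes _  | yes _  = s≤s (count-< xs z∈xs ¬pz qz)
  ... | yes px | no ¬qx = contradiction (P⊆Q px) ¬qx
  ... | no _   | yes _  = m≤n⇒m≤1+n (count-< xs z∈xs ¬pz qz)
  ... | no _   | no _   = count-< xs z∈xs ¬pz qz

==-sound : ∀ {b c} → T (b == c) → b ≡ c
==-sound {true}  {true}  _ = refl
==-sound {false} {false} _ = refl

==-complete : ∀ {b c} → b ≡ c → T (b == c)
==-complete {true}  refl = tt
==-complete {false} refl = tt

Adjacency : ℕ → Set
Adjacency n = Fin n → Fin n → Bool

Twin : ∀ {n} → Adjacency n → Fin n → Fin n → Set
Twin a x y = ∀ z → a x z ≡ a y z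

module _ {n : ℕ} (a : Adjacency n) where

  twin-sym : ∀ {x y} → Twin a x y → Twin a y x
  twin-sym t z = sym (t z)

  twin-trans : ∀ {x y w} → Twin a x y → Twin a y w → Twin a x w
  twin-trans t s z = trans (t z) (s z)

  twinᵇ-sound : ∀ {x y} → twinᵇ a x y ≡ true → Twin a x y
  twinᵇ-sound e z =
    ==-sound (All.lookup (all⁺ _ (allFin n) (Equivalence.from T-≡ e)) (∈-allFin z))

  twinᵇ-complete : ∀ {x y} → Twin a x y → twinᵇ a x y ≡ true
  twinᵇ-complete t =
    Equivalence.to T-≡ (all⁻ _ {allFin n} (All.tabulate (λ {z} _ → ==-complete (t z))))

  twinᵇ-cong : ∀ {x y} w → Twin a x y → twinᵇ a x w ≡ twinᵇ a y w
  twinᵇ-cong w t = cong and (map-cong (λ z → cong (_== a w z) (t z)) (allFin n))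

  not-rep⇒smaller-twin : ∀ {x} → isRepᵇ a x ≡ false →
                         ∃ λ y → y Fin.< x × Twin a y x
  not-rep⇒smaller-twin e
    with y , earlier-twin ← satisfied (any⁻ _ (allFin n) (Equivalence.from T-≡ (not-injective e)))
    with y<x , ty ← Equivalence.to T-∧ earlier-twin
    = y , <ᵇ⇒< _ _ y<x , twinᵇ-sound (Equivalence.to T-≡ ty)

  smaller-twin⇒not-rep : ∀ {x y} → y Fin.< x → Twin a y x → isRepᵇ a x ≡ false
  smaller-twin⇒not-rep {y = y} y<x t =
    cong not (Equivalence.to T-≡ (any⁺ _ (lose (∈-allFin y)
      (Equivalence.from T-∧ (<⇒<ᵇ y<x , Equivalence.from T-≡ (twinᵇ-complete t))))))

  representative : ∀ x → ∃ λ r → isRepᵇ a r ≡ true × Twin a r x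
  representative x = descend x (<-wellFounded x)
    where
    descend : ∀ x → Acc Fin._<_ x → ∃ λ r → isRepᵇ a r ≡ true × Twin a r x
    descend x (acc smaller) with isRepᵇ a x in rep
    ... | true  = x , rep , λ _ → refl
    ... | false with y , y<x , ty ← not-rep⇒smaller-twin rep
                with r , rr , tr ← descend y (smaller y<x)
                = r , rr , twin-trans tr ty

rep-preserved : ∀ {n} (a a' : Adjacency n) → (∀ {x y} → Twin a x y → Twin a' x y) →
  ∀ {x} → isRepᵇ a' x ≡ true → isRepᵇ a x ≡ true
rep-preserved a a' keep {x} rep' with isRepᵇ a x in rep
... | true = refl
... | false with y , y<x , t ← not-rep⇒smaller-twin a rep
  with () ← trans (sym rep') (smaller-twin⇒not-rep a' y<x (keep t))

lost-rep⇒τ< : ∀ {n} (a a' : Adjacency n) → (∀ {x y} → Twin a x y → Twin a' x y) →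
  ∀ {x} → isRepᵇ a x ≡ true → isRepᵇ a' x ≡ false → τ a' < τ a
lost-rep⇒τ< {n} a a' keep {x} rep ¬rep' =
  count-< (λ y → isRepᵇ a' y B.≟ true) (λ y → isRepᵇ a y B.≟ true)
          (rep-preserved a a' keep) (allFin n) (∈-allFin x)
          (λ rep' → contradiction (trans (sym rep') ¬rep') λ ()) rep

-- (1) If a' identifies every pair of a-twins and also some pair of non-twins,
-- then a' has strictly fewer twin classes than a: of the two representatives
-- of the merged classes, the later one is no longer a representative.
τ-decreases : ∀ {n} (a a' : Adjacency n) →
  (∀ {x y} → Twin a x y → Twin a' x y) →
  ∀ p q → ¬ Twin a p q → Twin a' p q → τ a' < τ a
τ-decreases a a' keep p q ¬twin twin'
  with r , rep-r , r~p ← representative a p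
  with s , rep-s , s~q ← representative a q
  with <-cmp (toℕ r) (toℕ s)
... | tri< r<s _ _ = lost-rep⇒τ< a a' keep rep-s (smaller-twin⇒not-rep a' r<s r~'s)
  where
  r~'s : Twin a' r s
  r~'s = twin-trans a' (keep r~p) (twin-trans a' twin' (keep (twin-sym a s~q)))
... | tri> _ _ s<r = lost-rep⇒τ< a a' keep rep-r (smaller-twin⇒not-rep a' s<r s~'r)
  where
  s~'r : Twin a' s r
  s~'r = twin-trans a' (keep s~q) (twin-trans a' (twin-sym a' twin') (keep (twin-sym a r~p)))
... | tri≈ _ r≡s _ with refl ← toℕ-injective r≡s =
  contradiction (twin-trans a (twin-sym a r~p) s~q) ¬twin

-- (2) The move.  moveAdj G u v a b is the following Boolean function of the
-- adjacency bit ab = A a b, the membership bits ta, tb of a, b in T(u), and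
-- the bits ub = A u b, vb = A v b, ua = A u a, va = A v a.
moveBit : (ab ta tb ub vb ua va : Bool) → Bool
moveBit ab ta tb ub vb ua va =
  (ab ∧ not ((ta ∧ (ub ∧ not vb)) ∨ (tb ∧ (ua ∧ not va)))) ∨
  ((ta ∧ (vb ∧ not ub)) ∨ (tb ∧ (va ∧ not ua)))

moveBit-both : ∀ {ab ta tb vb va} ub ua → ab ≡ false → ta ≡ true → tb ≡ true →
               vb ≡ false → va ≡ false → moveBit ab ta tb ub vb ua va ≡ vb
moveBit-both _ _ refl refl refl refl refl = refl

moveBit-source : ∀ {ab ta tb} ub vb ua va → ab ≡ ub → ta ≡ true → tb ≡ false →
                 moveBit ab ta tb ub vb ua va ≡ vb
moveBit-source true  true  _ _ refl refl refl = refl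
moveBit-source true  false _ _ refl refl refl = refl
moveBit-source false true  _ _ refl refl refl = refl
moveBit-source false false _ _ refl refl refl = refl

moveBit-target : ∀ {ab ta tb} ub vb ua va → ab ≡ ua → ta ≡ false → tb ≡ true →
                 moveBit ab ta tb ub vb ua va ≡ va
moveBit-target _ _ true  true  refl refl refl = refl
moveBit-target _ _ true  false refl refl refl = refl
moveBit-target _ _ false true  refl refl refl = refl
moveBit-target _ _ false false refl refl refl = refl

moveBit-neither : ∀ {ta tb} ab ub vb ua va → ta ≡ false → tb ≡ false →
                  moveBit ab ta tb ub vb ua va ≡ ab
moveBit-neither true  _ _ _ _ refl refl = refl
moveBit-neither false _ _ _ _ refl refl = refl

module Move {n : ℕ} (G : Graph n) (u v : Fin n) (u≁v : adj G u v ≡ false) where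

  open ≡-Reasoning

  A A' : Adjacency n
  A  = adj G
  A' = moveAdj G u v

  inT : Fin n → Bool
  inT w = twinᵇ A w u

  -- Case split on membership in T(u) that leaves inT untouched in the goal.
  membership : ∀ w → inT w ≡ true ⊎ inT w ≡ false
  membership w with inT w
  ... | true  = inj₁ refl
  ... | false = inj₂ refl

  moveAdj-bits : ∀ a b →
    A' a b ≡ moveBit (A a b) (inT a) (inT b) (A u b) (A v b) (A u a) (A v a)
  moveAdj-bits _ _ = refl

  T-independent : ∀ {a b} → Twin A a u → Twin A b u → A a b ≡ false
  T-independent {a} {b} a~u b~u =
    trans (a~u b) (trans (Graph.sym G u b) (trans (b~u u) (irrefl G u)))

  v≁T : ∀ {a} → Twin A a u → A v a ≡ false
  v≁T {a} a~u = trans (Graph.sym G v a) (trans (a~u v) u≁v)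

  row-moved : ∀ {a} z → inT a ≡ true → A' a z ≡ A v z
  row-moved {a} z a∈T with membership z
  ... | inj₁ z∈T = trans (moveAdj-bits a z) (moveBit-both (A u z) (A u a)
                  (T-independent a~u (twinᵇ-sound A z∈T)) a∈T z∈T
                  (v≁T (twinᵇ-sound A z∈T)) (v≁T a~u))
    where a~u = twinᵇ-sound A a∈T
  ... | inj₂ z∉T = trans (moveAdj-bits a z)
                  (moveBit-source (A u z) (A v z) (A u a) (A v a) (twinᵇ-sound A a∈T z) a∈T z∉T)

  column-moved : ∀ {a z} → inT a ≡ false → inT z ≡ true → A' a z ≡ A v a
  column-moved {a} {z} a∉T z∈T = trans (moveAdj-bits a z)
    (moveBit-target (A u z) (A v z) (A u a) (A v a)
                    (trans (Graph.sym G a z) (twinᵇ-sound A z∈T a)) a∉T z∈T)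

  unmoved : ∀ {a z} → inT a ≡ false → inT z ≡ false → A' a z ≡ A a z
  unmoved {a} {z} a∉T z∉T = trans (moveAdj-bits a z)
    (moveBit-neither (A a z) (A u z) (A v z) (A u a) (A v a) a∉T z∉T)

  inT-cong : ∀ {x y} → Twin A x y → inT x ≡ inT y
  inT-cong x~y = twinᵇ-cong A u x~y

  twins-stay : ∀ {x y} → Twin A x y → Twin A' x y
  twins-stay {x} {y} x~y z with membership x
  ... | inj₁ x∈T = trans (row-moved z x∈T) (sym (row-moved z (trans (sym (inT-cong x~y)) x∈T)))
  ... | inj₂ x∉T with membership z
  ...   | inj₁ z∈T = begin
          A' x z  ≡⟨ column-moved x∉T z∈T ⟩
          A v x   ≡⟨ Graph.sym G v x ⟩
          A x v   ≡⟨ x~y v ⟩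
          A y v   ≡⟨ Graph.sym G y v ⟩
          A v y   ≡⟨ sym (column-moved y∉T z∈T) ⟩
          A' y z  ∎
    where y∉T = trans (sym (inT-cong x~y)) x∉T
  ...   | inj₂ z∉T = trans (unmoved x∉T z∉T) (trans (x~y z) (sym (unmoved y∉T z∉T)))
    where y∉T = trans (sym (inT-cong x~y)) x∉T

  u∈T : inT u ≡ true
  u∈T = twinᵇ-complete A (λ _ → refl)

  v∉T : ¬ Twin A u v → inT v ≡ false
  v∉T ¬u~v with membership v
  ... | inj₁ v∈T = contradiction (twin-sym A (twinᵇ-sound A v∈T)) ¬u~v
  ... | inj₂ v∉T = v∉T

  -- After the move u and v are twins: the row of u becomes the old row of v,
  -- which v keeps except on T(u), where both rows are 0.
  u~v : ¬ Twin A u v → Twin A' u v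
  u~v ¬u~v z with membership z
  ... | inj₁ z∈T = begin
        A' u z  ≡⟨ row-moved z u∈T ⟩
        A v z   ≡⟨ v≁T (twinᵇ-sound A z∈T) ⟩
        false   ≡⟨ sym (irrefl G v) ⟩
        A v v   ≡⟨ sym (column-moved (v∉T ¬u~v) z∈T) ⟩
        A' v z  ∎
  ... | inj₂ z∉T = trans (row-moved z u∈T) (sym (unmoved (v∉T ¬u~v) z∉T))

lemma4 : ∀ {n : ℕ} (G : Graph n) (u v : Fin n) →
    TriangleFree G → adj G u v ≡ false → ¬ Twins G u v →
    τ (moveAdj G u v) < τ (adj G)
lemma4 G u v _ u≁v ¬twins =
  τ-decreases (adj G) (moveAdj G u v) twins-stay u v ¬twins (u~v ¬twins)
  where open Move G u v u≁v
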